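{- Let $G$ be a finite connected graph (multiple edges allowed, no loops) and let $G'$ be a subdivision of $G$. Then $\mathrm{sn}(G)=\mathrm{sn}(G')$.
   Context: If $e$ is an edge of $G$ with endpoints $v,w$, the edge-subdivision of $G$ at $e$ is the graph with vertex set $V(G)\cup\{u\}$ ($u$ a new vertex) and edge set $(E(G)\setminus\{e\})\cup\{uv,uw\}$. A subdivision of $G$ is a graph obtained from $G$ by finitely many edge-subdivisions. For $A,B\subseteq V(G)$, $E(A,B)$ is the set of edges with one endpoint in $A$ and the other in $B$; $A^c=V(G)\setminus A$. A set $B\subseteq V(G)$ is connected if for every proper subset $A\subsetneq B$ the set $E(A,B\setminus A)$ is nonempty. A scramble is a finite set $\mathscr{S}$ of connected subsets of $V(G)$ (eggs). A hitting set is a set $C\subseteq V(G)$ meeting every egg. The scramble order $\|\mathscr{S}\|$ is the maximum integer $k$ such that (1) no $C\subseteq V(G)$ with $|C|<k$ is a hitting set for $\mathscr{S}$, and (2) for every $A\subseteq V(G)$ for which there are eggs $E,E'\in\mathscr{S}$ with $E\subseteq A$ and $E'\subseteq A^c$, one has $|E(A,A^c)|\geq k$. The scramble number $\mathrm{sn}(G)$ is the maximum scramble order of a scramble in $G$. -}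

module Defs where

open import Data.Nat using (ℕ; zero; suc; _+_; _≤_; _<_)
open import Data.Bool using (Bool; true; false; _∧_; _∨_; if_then_else_)
open import Data.Fin using (Fin; inject₁; fromℕ)
open import Data.Fin.Subset using (Subset; _⊆_; _⊂_; ∁; _─_; ∣_∣; Nonempty; _∩_)
open import Data.Product using (_×_; _,_; proj₁; proj₂; Σ)
open import Data.List using (List; []; _∷_; length; map; removeAt)
open import Data.List.Relation.Unary.All using (All)
open import Data.List.Relation.Unary.Any using (Any)
open import Data.Vec using (lookup)
open import Relation.Binary.PropositionalEquality using (_≡_; _≢_)
open import Relation.Nullary using (¬_)
open import Function.Bundles using (_⇔_)

-- A finite multigraph: vertices are Fin nV, edges a finite list (multiset)
-- of unordered pairs, each stored as an (arbitrarily oriented) pair of endpoints.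
record Graph : Set where
  constructor mkGraph
  field
    nV    : ℕ
    edges : List (Fin nV × Fin nV)
open Graph public

Loopless : Graph → Set
Loopless G = All (λ e → proj₁ e ≢ proj₂ e) (edges G)

crosses : ∀ {n} → Subset n → Subset n → Fin n × Fin n → Bool
crosses A B (u , v) = (lookup A u ∧ lookup B v) ∨ (lookup B u ∧ lookup A v)

countCross : ∀ {n} → Subset n → Subset n → List (Fin n × Fin n) → ℕ
countCross A B []       = 0
countCross A B (e ∷ es) = (if crosses A B e then 1 else 0) + countCross A B es

cut : (G : Graph) → Subset (nV G) → Subset (nV G) → ℕ
cut G A B = countCross A B (edges G)

ConnectedSet : (G : Graph) → Subset (nV G) → Set
ConnectedSet G B =
  Nonempty B × (∀ (A : Subset (nV G)) → Nonempty A → A ⊂ B → 1 ≤ cut G A (B ─ A))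

ConnectedGraph : Graph → Set
ConnectedGraph G = ConnectedSet G (Data.Fin.Subset.⊤)

subdivideAt : (G : Graph) → Fin (length (edges G)) → Graph
subdivideAt (mkGraph n es) i =
  mkGraph (suc n)
    ((fromℕ n , inject₁ (proj₁ (lookupL es i))) ∷ (fromℕ n , inject₁ (proj₂ (lookupL es i)))
       ∷ map (λ e → inject₁ (proj₁ e) , inject₁ (proj₂ e)) (removeAt es i))
  where
  lookupL : {A : Set} → (xs : List A) → Fin (length xs) → A
  lookupL xs j = Data.List.lookup xs j

data Subdivision (G : Graph) : Graph → Set where
  here : Subdivision G G
  step : ∀ {H} → Subdivision G H → (i : Fin (length (edges H))) → Subdivision G (subdivideAt H i)

record Scramble (G : Graph) : Set where
  constructor mkScramble
  field
    eggs      : List (Subset (nV G))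
    connected : All (ConnectedSet G) eggs
open Scramble public

HittingSet : (G : Graph) → Subset (nV G) → Scramble G → Set
HittingSet G C S = All (λ E → Nonempty (C ∩ E)) (eggs S)

OrderCond : (G : Graph) → Scramble G → ℕ → Set
OrderCond G S k =
  (∀ (C : Subset (nV G)) → ∣ C ∣ < k → ¬ HittingSet G C S)
  × (∀ (A : Subset (nV G)) → Any (λ E → E ⊆ A) (eggs S) → Any (λ E → E ⊆ ∁ A) (eggs S)
       → k ≤ cut G A (∁ A))

IsScrambleOrder : (G : Graph) → Scramble G → ℕ → Set
IsScrambleOrder G S k = OrderCond G S k × (∀ j → OrderCond G S j → j ≤ k)

IsScrambleNumber : Graph → ℕ → Set
IsScrambleNumber G s =
  Σ (Scramble G) (λ S → IsScrambleOrder G S s)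
  × (∀ (S : Scramble G) (k : ℕ) → IsScrambleOrder G S k → k ≤ s)

-- Let G′ arise from G by subdividing the edge ab with a new vertex u. Both conditions on a
-- scramble only involve hitting sets and cuts |E(A, ∁A)|, and such a cut is a count of
-- separated edges, where ab is replaced by the path a–u–b.
--
-- A scramble of G lifts to G′ by adding u to the eggs containing a. A hitting set of G′ gives
-- one of G, no larger, by replacing u with a, and a cut of G′ is at least the cut of G it
-- restricts to, since when ab is separated so is one edge of a–u–b.
--
-- Conversely, a scramble of G′ contracts to G by removing u from every egg, the egg {u} (if
-- present) becoming the two eggs {a} and {b}; eggs stay connected because a connected set
-- through u contains a or b. A hitting set C of G is one of G′ unless {u} is an egg; then C
-- contains a and b, while deg u = 2 bounds the order by 2. A cut A of G keeping a and b on
-- one side lifts, u joining that side, to a cut of G′ of the same size. If A separates a from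
-- b, then either some egg of G′ lies on one side of A and A lifts with u on the other side, or
-- u together with one endpoint of every other separated edge hits all eggs; in both cases the
-- order is at most |E(A, ∁A)|. So G and G′ admit scrambles of the same orders.

module Submission where

open import Defs

open import Algebra.Properties.CommutativeSemigroup using (x∙yz≈y∙xz)
open import Data.Bool using (Bool; true; false; not; _∧_; _∨_; _xor_; if_then_else_)
import Data.Bool as Bool
open import Data.Bool.Properties using (¬-not; xor-same; xor-comm; ∧-zeroʳ; ∧-identityʳ; ∨-identityʳ)
open import Data.Empty using (⊥-elim)
open import Data.Fin using (Fin; zero; suc; inject₁; fromℕ)
open import Data.Fin.Properties using (fromℕ≢inject₁; inject₁-injective)
open import Data.Fin.Subset using (Subset; _∈_; _∉_; _⊆_; ∁; _∩_; _∪_; _─_; ∣_∣; Nonempty; Empty; ⁅_⁆; ⊤; ⊥)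
open import Data.Fin.Subset.Properties
  using ( _∈?_; _⊆?_; nonempty?; anySubset?; drop-∷-⊆; ⊆-antisym; ∈⊤; ∣⊤∣≡n; ∣⊥∣≡0; ∣p∣≤∣x∷p∣; p⊂q⇒∣p∣<∣q∣
        ; x∈⁅x⁆; x∈⁅y⁆⇒x≡y; x≢y⇒x∉⁅y⁆; ∣⁅x⁆∣≡1; x∉p⇒x∈∁p; ∩-identityˡ; p∩q⊆p; p∩q⊆q; x∈p∩q⁺; x∈p∩q⁻
        ; q⊆p∪q; x∈p∪q⁺; p─⊥≡p; x∈p∧x∉q⇒x∈p─q )
open import Data.List using (List; []; _∷_; map; removeAt)
import Data.List as List
open import Data.List.Membership.Propositional using (find; lose) renaming (_∈_ to _∈ₗ_)
open import Data.List.Membership.Propositional.Properties using (∈-lookup)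
open import Data.List.Properties using (map-∘; map-cong)
open import Data.List.Relation.Unary.All as All using (All; []; _∷_)
import Data.List.Relation.Unary.All.Properties as All
open import Data.List.Relation.Unary.Any as Any using (Any)
import Data.List.Relation.Unary.Any.Properties as Any
open import Data.Nat using (ℕ; zero; suc; _+_; _≤_; _<_; z≤n; s≤s; s≤s⁻¹; _≤?_; _<?_)
open import Data.Nat.ListAction using (sum)
open import Data.Nat.Properties
open import Data.Product using (Σ; _×_; _,_; proj₁; proj₂)
open import Data.Sum using (_⊎_; inj₁; inj₂)
import Data.Sum as Sum
open import Data.Vec using (Vec; []; _∷_; _∷ʳ_; here; there; lookup; zipWith; init; last; initLast)
open import Data.Vec.Properties using (lookup-map; lookup-zipWith; lookup-replicate; map-∷ʳ; []=⇒lookup; lookup⇒[]=)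
open import Function using (_∘_)
open import Function.Bundles using (_⇔_; mk⇔; Equivalence)
open import Function.Properties.Equivalence using () renaming (refl to ⇔-refl; sym to ⇔-sym; trans to ⇔-trans)
open import Relation.Binary.PropositionalEquality
open import Relation.Nullary using (¬_; Dec; yes; no; contradiction)
open import Relation.Nullary.Decidable using (¬?; _×-dec_; _→-dec_; decidable-stable)
open import Relation.Unary using (Decidable)

open ≤-Reasoning

-- Counting with booleans

𝟙 : Bool → ℕ
𝟙 b = if b then 1 else 0

𝟙≤1 : ∀ b → 𝟙 b ≤ 1
𝟙≤1 false = z≤n
𝟙≤1 true  = ≤-refl

∧≡true⁻ : ∀ {x y} → x ∧ y ≡ true → x ≡ true × y ≡ true
∧≡true⁻ {true} {true} _ = refl , refl

𝟙-xor-triangle : ∀ x y z → 𝟙 (y xor z) ≤ 𝟙 (x xor y) + 𝟙 (x xor z)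
𝟙-xor-triangle false false z = ≤-refl
𝟙-xor-triangle true  true  z = ≤-refl
𝟙-xor-triangle false true  z = ≤-trans (𝟙≤1 _) (m≤m+n 1 _)
𝟙-xor-triangle true  false z = ≤-trans (𝟙≤1 _) (m≤m+n 1 _)

𝟙-xor-between : ∀ x y z → x ≡ y ⊎ x ≡ z → 𝟙 (x xor y) + 𝟙 (x xor z) ≡ 𝟙 (y xor z)
𝟙-xor-between y y z (inj₁ refl) rewrite xor-same y = refl
𝟙-xor-between z y z (inj₂ refl) rewrite xor-same z = trans (+-identityʳ _) (cong 𝟙 (xor-comm z y))

≢⇒xor : ∀ {x y : Bool} → x ≢ y → x xor y ≡ true
≢⇒xor {true}  {true}  x≢y = ⊥-elim (x≢y refl)
≢⇒xor {true}  {false} _   = refl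
≢⇒xor {false} {true}  _   = refl
≢⇒xor {false} {false} x≢y = ⊥-elim (x≢y refl)

≢⇒either : ∀ {x y : Bool} → x ≢ y → ∀ z → z ≡ x ⊎ z ≡ y
≢⇒either {true}  {true}  x≢y _     = ⊥-elim (x≢y refl)
≢⇒either {false} {false} x≢y _     = ⊥-elim (x≢y refl)
≢⇒either {true}  {false} _   true  = inj₁ refl
≢⇒either {true}  {false} _   false = inj₂ refl
≢⇒either {false} {true}  _   true  = inj₂ refl
≢⇒either {false} {true}  _   false = inj₁ refl

∧-xor≡false⇒ : ∀ e x y → e ∧ (x xor y) ≡ false → (e ∧ x ≡ e ∧ y) × (e ∧ not x ≡ e ∧ not y)
∧-xor≡false⇒ false _     _     _  = refl , refl
∧-xor≡false⇒ true  true  true  _  = refl , refl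
∧-xor≡false⇒ true  false false _  = refl , refl
∧-xor≡false⇒ true  true  false ()
∧-xor≡false⇒ true  false true  ()

𝟙-edge≤path : ∀ β ba bb x xa xb → (ba ∧ bb ≡ true → β ≡ true) →
  𝟙 ((ba ∧ bb) ∧ (xa xor xb)) ≤ 𝟙 ((β ∧ ba) ∧ (x xor xa)) + 𝟙 ((β ∧ bb) ∧ (x xor xb))
𝟙-edge≤path β true  true  x xa xb h rewrite h refl = 𝟙-xor-triangle x xa xb
𝟙-edge≤path β true  false x xa xb h = z≤n
𝟙-edge≤path β false bb    x xa xb h = z≤n

𝟙-path≤edge : ∀ β ba bb xa xb → let x = if ba then xa else xb in
  𝟙 ((β ∧ ba) ∧ (x xor xa)) + 𝟙 ((β ∧ bb) ∧ (x xor xb)) ≤ 𝟙 ((ba ∧ bb) ∧ (xa xor xb))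
𝟙-path≤edge false ba    bb xa xb = z≤n
𝟙-path≤edge true  true  bb xa xb rewrite xor-same xa = ≤-refl
𝟙-path≤edge true  false bb xa xb rewrite xor-same xb | ∧-zeroʳ bb = ≤-refl

sum-map-removeAt : ∀ {A : Set} (f : A → ℕ) xs i → sum (map f xs) ≡ f (List.lookup xs i) + sum (map f (removeAt xs i))
sum-map-removeAt f (x ∷ xs) zero    = refl
sum-map-removeAt f (x ∷ xs) (suc i) = trans (cong (f x +_) (sum-map-removeAt f xs i))
  (x∙yz≈y∙xz +-commutativeSemigroup (f x) (f (List.lookup xs i)) (sum (map f (removeAt xs i))))

1≤sum-𝟙⇒Any : ∀ {A : Set} (f : A → Bool) xs → 1 ≤ sum (map (𝟙 ∘ f) xs) → Any (λ x → f x ≡ true) xs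
1≤sum-𝟙⇒Any f (x ∷ xs) pos with f x in fx
... | true  = Any.here fx
... | false = Any.there (1≤sum-𝟙⇒Any f xs pos)

-- Vertex sets with a distinguished last vertex

lookup-∷ʳ-inject₁ : ∀ {A : Set} {n} (xs : Vec A n) x j → lookup (xs ∷ʳ x) (inject₁ j) ≡ lookup xs j
lookup-∷ʳ-inject₁ (y ∷ xs) x zero    = refl
lookup-∷ʳ-inject₁ (y ∷ xs) x (suc j) = lookup-∷ʳ-inject₁ xs x j

lookup-∷ʳ-fromℕ : ∀ {A : Set} {n} (xs : Vec A n) x → lookup (xs ∷ʳ x) (fromℕ n) ≡ x
lookup-∷ʳ-fromℕ []       x = refl
lookup-∷ʳ-fromℕ (y ∷ xs) x = lookup-∷ʳ-fromℕ xs x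

zipWith-∷ʳ : ∀ {A B C : Set} {n} (f : A → B → C) (xs : Vec A n) ys x y →
  zipWith f (xs ∷ʳ x) (ys ∷ʳ y) ≡ zipWith f xs ys ∷ʳ f x y
zipWith-∷ʳ f []       []       x y = refl
zipWith-∷ʳ f (x′ ∷ xs) (y′ ∷ ys) x y = cong (f x′ y′ ∷_) (zipWith-∷ʳ f xs ys x y)

lookup-∩ : ∀ {n} (p q : Subset n) j → lookup (p ∩ q) j ≡ lookup p j ∧ lookup q j
lookup-∩ p q j = lookup-zipWith _∧_ j p q

lookup-─ : ∀ {n} (p q : Subset n) j → lookup (p ─ q) j ≡ lookup p j ∧ not (lookup q j)
lookup-─ (x ∷ p) (true  ∷ q) zero    = sym (∧-zeroʳ x)
lookup-─ (x ∷ p) (false ∷ q) zero    = sym (∧-identityʳ x)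
lookup-─ (x ∷ p) (y     ∷ q) (suc j) = lookup-─ p q j

⊤─p≡∁p : ∀ {n} (p : Subset n) → ⊤ ─ p ≡ ∁ p
⊤─p≡∁p []          = refl
⊤─p≡∁p (true  ∷ p) = cong (false ∷_) (⊤─p≡∁p p)
⊤─p≡∁p (false ∷ p) = cong (true ∷_) (⊤─p≡∁p p)

p─p∩q≡p─q : ∀ {n} (p q : Subset n) → p ─ (p ∩ q) ≡ p ─ q
p─p∩q≡p─q []          []          = refl
p─p∩q≡p─q (true  ∷ p) (true  ∷ q) = cong (false ∷_) (p─p∩q≡p─q p q)
p─p∩q≡p─q (true  ∷ p) (false ∷ q) = cong (true ∷_) (p─p∩q≡p─q p q)
p─p∩q≡p─q (false ∷ p) (true  ∷ q) = cong (false ∷_) (p─p∩q≡p─q p q)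
p─p∩q≡p─q (false ∷ p) (false ∷ q) = cong (false ∷_) (p─p∩q≡p─q p q)

x∈p─q⁻ : ∀ {n} {x : Fin n} (p q : Subset n) → x ∈ p ─ q → x ∈ p × x ∉ q
x∈p─q⁻ {x = x} p q x∈ with ∧≡true⁻ (trans (sym (lookup-─ p q x)) ([]=⇒lookup x∈))
... | x∈p , x∉q = lookup⇒[]= x p x∈p ,
  λ x∈q → contradiction (subst (λ b → not b ≡ true) ([]=⇒lookup x∈q) x∉q) λ ()

∩-∷ʳ : ∀ {n} (p q : Subset n) x y → (p ∷ʳ x) ∩ (q ∷ʳ y) ≡ (p ∩ q) ∷ʳ (x ∧ y)
∩-∷ʳ = zipWith-∷ʳ _∧_

─-∷ʳ : ∀ {n} (p q : Subset n) x y → (p ∷ʳ x) ─ (q ∷ʳ y) ≡ (p ─ q) ∷ʳ (x ∧ not y)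
─-∷ʳ [] [] x true  = cong (_∷ []) (sym (∧-zeroʳ x))
─-∷ʳ [] [] x false = cong (_∷ []) (sym (∧-identityʳ x))
─-∷ʳ (p₀ ∷ p) (q₀ ∷ q) x y = cong (_ ∷_) (─-∷ʳ p q x y)

∁-∷ʳ : ∀ {n} (p : Subset n) x → ∁ (p ∷ʳ x) ≡ ∁ p ∷ʳ not x
∁-∷ʳ p x = map-∷ʳ not x p

∣∷ʳ∣ : ∀ {n} (p : Subset n) x → ∣ p ∷ʳ x ∣ ≡ ∣ p ∣ + 𝟙 x
∣∷ʳ∣ []          true  = refl
∣∷ʳ∣ []          false = refl
∣∷ʳ∣ (true  ∷ p) x     = cong suc (∣∷ʳ∣ p x)
∣∷ʳ∣ (false ∷ p) x     = ∣∷ʳ∣ p x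

∣p∪q∣≤∣p∣+∣q∣ : ∀ {n} (p q : Subset n) → ∣ p ∪ q ∣ ≤ ∣ p ∣ + ∣ q ∣
∣p∪q∣≤∣p∣+∣q∣ []          []          = z≤n
∣p∪q∣≤∣p∣+∣q∣ (true  ∷ p) (y     ∷ q) = s≤s (≤-trans (∣p∪q∣≤∣p∣+∣q∣ p q) (+-monoʳ-≤ ∣ p ∣ (∣p∣≤∣x∷p∣ y q)))
∣p∪q∣≤∣p∣+∣q∣ (false ∷ p) (true  ∷ q) = ≤-trans (s≤s (∣p∪q∣≤∣p∣+∣q∣ p q)) (≤-reflexive (sym (+-suc ∣ p ∣ ∣ q ∣)))
∣p∪q∣≤∣p∣+∣q∣ (false ∷ p) (false ∷ q) = ∣p∪q∣≤∣p∣+∣q∣ p q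

⊤-∷ʳ : ∀ n → ⊤ {suc n} ≡ ⊤ {n} ∷ʳ true
⊤-∷ʳ zero    = refl
⊤-∷ʳ (suc n) = cong (true ∷_) (⊤-∷ʳ n)

⁅fromℕ⁆ : ∀ n → ⁅ fromℕ n ⁆ ≡ ⊥ {n} ∷ʳ true
⁅fromℕ⁆ zero    = refl
⁅fromℕ⁆ (suc n) = cong (false ∷_) (⁅fromℕ⁆ n)

∷ʳ-⊆⁺ : ∀ {n} {p q : Subset n} {x y} → p ⊆ q → (x ≡ true → y ≡ true) → p ∷ʳ x ⊆ q ∷ʳ y
∷ʳ-⊆⁺ {p = []}    {[]}    _   x⇒y here rewrite x⇒y refl = here
∷ʳ-⊆⁺ {p = _ ∷ p} {_ ∷ q} p⊆q x⇒y here with p⊆q here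
... | here = here
∷ʳ-⊆⁺ {p = _ ∷ p} {_ ∷ q} p⊆q x⇒y (there v∈) = there (∷ʳ-⊆⁺ (drop-∷-⊆ p⊆q) x⇒y v∈)

∷ʳ-⊆⁻ : ∀ {n} {p q : Subset n} {x y} → p ∷ʳ x ⊆ q ∷ʳ y → p ⊆ q
∷ʳ-⊆⁻ {p = _ ∷ p} {_ ∷ q} ⊆∷ʳ here with ⊆∷ʳ here
... | here = here
∷ʳ-⊆⁻ {p = _ ∷ p} {_ ∷ q} ⊆∷ʳ (there v∈) = there (∷ʳ-⊆⁻ (drop-∷-⊆ ⊆∷ʳ) v∈)

inject₁∈∷ʳ : ∀ {n} {p : Subset n} {j} x → j ∈ p → inject₁ j ∈ p ∷ʳ x
inject₁∈∷ʳ x here        = here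
inject₁∈∷ʳ x (there j∈) = there (inject₁∈∷ʳ x j∈)

fromℕ∈∷ʳ : ∀ {n} (p : Subset n) → fromℕ n ∈ p ∷ʳ true
fromℕ∈∷ʳ []      = here
fromℕ∈∷ʳ (_ ∷ p) = there (fromℕ∈∷ʳ p)

Nonempty-∷ʳ⁺ : ∀ {n} {p : Subset n} x → Nonempty p → Nonempty (p ∷ʳ x)
Nonempty-∷ʳ⁺ x (j , j∈) = inject₁ j , inject₁∈∷ʳ x j∈

Nonempty-∷ʳ⁻ : ∀ {n} (p : Subset n) {x} → Nonempty (p ∷ʳ x) → Nonempty p ⊎ x ≡ true
Nonempty-∷ʳ⁻ []      (zero , here) = inj₂ refl
Nonempty-∷ʳ⁻ (_ ∷ p) (zero , here) = inj₁ (zero , here)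
Nonempty-∷ʳ⁻ (_ ∷ p) (suc v , there v∈) with Nonempty-∷ʳ⁻ p (v , v∈)
... | inj₁ (j , j∈) = inj₁ (suc j , there j∈)
... | inj₂ x≡true   = inj₂ x≡true

Nonempty-∷ʳ-lookup⁻ : ∀ {n} (p : Subset n) j → Nonempty (p ∷ʳ lookup p j) → Nonempty p
Nonempty-∷ʳ-lookup⁻ p j ne with Nonempty-∷ʳ⁻ p ne
... | inj₁ nonempty = nonempty
... | inj₂ j∈p      = j , lookup⇒[]= j p j∈p

init-∷ʳ-last : ∀ {A : Set} {n} (xs : Vec A (suc n)) → xs ≡ init xs ∷ʳ last xs
init-∷ʳ-last xs = proj₂ (proj₂ (initLast xs))

⊆-∷ʳ-init : ∀ {n} {E′ : Subset (suc n)} {T y} → init E′ ⊆ T → (last E′ ≡ true → y ≡ true) → E′ ⊆ T ∷ʳ y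
⊆-∷ʳ-init {E′ = E′} init⊆T last⇒y = subst (_⊆ _) (sym (init-∷ʳ-last E′)) (∷ʳ-⊆⁺ init⊆T last⇒y)

two≤∣p∣ : ∀ {n} {x y : Fin n} {p} → x ≢ y → x ∈ p → y ∈ p → 2 ≤ ∣ p ∣
two≤∣p∣ {x = x} {y} {p} x≢y x∈p y∈p = subst (_< ∣ p ∣) (∣⁅x⁆∣≡1 x)
  (p⊂q⇒∣p∣<∣q∣ ((λ w∈ → subst (_∈ p) (sym (x∈⁅y⁆⇒x≡y x w∈)) x∈p) , y , y∈p , x≢y⇒x∉⁅y⁆ (x≢y ∘ sym)))

sourcesOf : ∀ {n} → (Fin n × Fin n → Bool) → List (Fin n × Fin n) → Subset n
sourcesOf f []       = ⊥
sourcesOf f (e ∷ es) = if f e then ⁅ proj₁ e ⁆ ∪ sourcesOf f es else sourcesOf f es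

∣sourcesOf∣ : ∀ {n} f (es : List (Fin n × Fin n)) → ∣ sourcesOf f es ∣ ≤ sum (map (𝟙 ∘ f) es)
∣sourcesOf∣ {n} f []       = ≤-reflexive (∣⊥∣≡0 n)
∣sourcesOf∣ f (e ∷ es) with f e
... | true  = ≤-trans (∣p∪q∣≤∣p∣+∣q∣ ⁅ proj₁ e ⁆ (sourcesOf f es))
                      (≤-trans (≤-reflexive (cong (_+ _) (∣⁅x⁆∣≡1 (proj₁ e)))) (s≤s (∣sourcesOf∣ f es)))
... | false = ∣sourcesOf∣ f es

sourcesOf-∈ : ∀ {n} f {es : List (Fin n × Fin n)} {e} → e ∈ₗ es → f e ≡ true → proj₁ e ∈ sourcesOf f es
sourcesOf-∈ f {e ∷ es} (Any.here refl) fe rewrite fe = x∈p∪q⁺ (inj₁ (x∈⁅x⁆ _))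
sourcesOf-∈ f {e′ ∷ es} (Any.there e∈) fe with f e′
... | true  = x∈p∪q⁺ (inj₂ (sourcesOf-∈ f e∈ fe))
... | false = sourcesOf-∈ f e∈ fe

-- Separated edges, cuts and connectivity

separates : ∀ {n} → Subset n → Subset n → Fin n × Fin n → Bool
separates B X (p , q) = (lookup B p ∧ lookup B q) ∧ (lookup X p xor lookup X q)

separated : ∀ {n} → Subset n → Subset n → List (Fin n × Fin n) → ℕ
separated B X es = sum (map (𝟙 ∘ separates B X) es)

crosses-∩-─ : ∀ {n} (B X : Subset n) e → crosses (B ∩ X) (B ─ X) e ≡ separates B X e
crosses-∩-─ B X (p , q)
  rewrite lookup-∩ B X p | lookup-∩ B X q | lookup-─ B X p | lookup-─ B X q
  = truthTable (lookup B p) (lookup B q) (lookup X p) (lookup X q)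
  where
  truthTable : ∀ bp bq xp xq →
    ((bp ∧ xp) ∧ (bq ∧ not xq)) ∨ ((bp ∧ not xp) ∧ (bq ∧ xq)) ≡ (bp ∧ bq) ∧ (xp xor xq)
  truthTable false bq xp    xq = refl
  truthTable true  bq true  xq = ∨-identityʳ _
  truthTable true  bq false xq = refl

countCross-∩-─ : ∀ {n} (B X : Subset n) es → countCross (B ∩ X) (B ─ X) es ≡ separated B X es
countCross-∩-─ B X []       = refl
countCross-∩-─ B X (e ∷ es) = cong₂ _+_ (cong 𝟙 (crosses-∩-─ B X e)) (countCross-∩-─ B X es)

cut-∁ : ∀ G (A : Subset (nV G)) → cut G A (∁ A) ≡ separated ⊤ A (edges G)
cut-∁ G A = begin-equality
  cut G A (∁ A)         ≡⟨ cong₂ (cut G) (sym (∩-identityˡ A)) (sym (⊤─p≡∁p A)) ⟩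
  cut G (⊤ ∩ A) (⊤ ─ A) ≡⟨ countCross-∩-─ ⊤ A (edges G) ⟩
  separated ⊤ A (edges G) ∎

separates-⊤ : ∀ {n} (A : Subset n) p q → separates ⊤ A (p , q) ≡ lookup A p xor lookup A q
separates-⊤ A p q rewrite lookup-replicate p true | lookup-replicate q true = refl

separated-⊥ : ∀ {n} (B : Subset n) es → separated B ⊥ es ≡ 0
separated-⊥ B []            = refl
separated-⊥ B ((p , q) ∷ es)
  rewrite lookup-replicate p false | lookup-replicate q false | ∧-zeroʳ (lookup B p ∧ lookup B q)
  = separated-⊥ B es

connected⇒separated : ∀ G {B X : Subset (nV G)} → ConnectedSet G B →
  Nonempty (B ∩ X) → Nonempty (B ─ X) → 1 ≤ separated B X (edges G)
connected⇒separated G {B} {X} (_ , conn) meets (j , j∈B─X) with x∈p─q⁻ B X j∈B─X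
... | j∈B , j∉X = begin
  1                           ≤⟨ conn (B ∩ X) meets (p∩q⊆p B X , j , j∈B , j∉X ∘ proj₂ ∘ x∈p∩q⁻ B X) ⟩
  cut G (B ∩ X) (B ─ (B ∩ X)) ≡⟨ cong (cut G (B ∩ X)) (p─p∩q≡p─q B X) ⟩
  cut G (B ∩ X) (B ─ X)       ≡⟨ countCross-∩-─ B X (edges G) ⟩
  separated B X (edges G)     ∎

separated⇒connected : ∀ G {B : Subset (nV G)} → Nonempty B →
  (∀ X → Nonempty (B ∩ X) → Nonempty (B ─ X) → 1 ≤ separated B X (edges G)) → ConnectedSet G B
separated⇒connected G {B} nonempty splitting = nonempty , λ where
  X (j , j∈X) (X⊆B , k , k∈B , k∉X) → begin
    1                       ≤⟨ splitting X (j , x∈p∩q⁺ (X⊆B j∈X , j∈X)) (k , x∈p∧x∉q⇒x∈p─q k∈B k∉X) ⟩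
    separated B X (edges G) ≡⟨ countCross-∩-─ B X (edges G) ⟨
    cut G (B ∩ X) (B ─ X)   ≡⟨ cong (λ Y → cut G Y (B ─ X)) (⊆-antisym (p∩q⊆q B X) (λ m → x∈p∩q⁺ (X⊆B m , m))) ⟩
    cut G X (B ─ X)         ∎

⁅⁆-connected : ∀ G (v : Fin (nV G)) → ConnectedSet G ⁅ v ⁆
⁅⁆-connected G v = separated⇒connected G (v , x∈⁅x⁆ v) λ X (w , w∈⁅v⁆∩X) (w′ , w′∈⁅v⁆─X) →
  let w∈⁅v⁆ , w∈X   = x∈p∩q⁻ ⁅ v ⁆ X w∈⁅v⁆∩X
      w′∈⁅v⁆ , w′∉X = x∈p─q⁻ ⁅ v ⁆ X w′∈⁅v⁆─X
  in contradiction (subst (_∈ X) (trans (x∈⁅y⁆⇒x≡y v w∈⁅v⁆) (sym (x∈⁅y⁆⇒x≡y v w′∈⁅v⁆))) w∈X) w′∉X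

-- Scramble orders

∀-Subset? : ∀ {n} {P : Subset n → Set} → Decidable P → Dec (∀ C → P C)
∀-Subset? P? with anySubset? (¬? ∘ P?)
... | yes (C , ¬PC) = no λ ∀P → ¬PC (∀P C)
... | no ∄¬P        = yes λ C → decidable-stable (P? C) (λ ¬PC → ∄¬P (C , ¬PC))

Achievable : Graph → ℕ → Set
Achievable H k = Σ (Scramble H) (λ S → OrderCond H S k)

module _ (H : Graph) (S : Scramble H) where

  OrderCond-zero : OrderCond H S 0
  OrderCond-zero = (λ _ ()) , (λ _ _ _ → z≤n)

  OrderCond⇒≤nV : ∀ {k} → OrderCond H S k → k ≤ nV H
  OrderCond⇒≤nV (noHit , _) = ≮⇒≥ λ n<k →
    noHit ⊤ (subst (_< _) (sym (∣⊤∣≡n (nV H))) n<k)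
      (All.map (λ ((v , v∈E) , _) → v , x∈p∩q⁺ (∈⊤ , v∈E)) (connected S))

  OrderCond? : ∀ k → Dec (OrderCond H S k)
  OrderCond? k =
    ∀-Subset? (λ C → ∣ C ∣ <? k →-dec ¬? (All.all? (λ E → nonempty? (C ∩ E)) (eggs S)))
    ×-dec ∀-Subset? (λ A → Any.any? (λ E → E ⊆? A) (eggs S) →-dec
                          Any.any? (λ E → E ⊆? ∁ A) (eggs S) →-dec k ≤? cut H A (∁ A))

greatest : ∀ {P : ℕ → Set} → Decidable P → P 0 → ∀ N → (∀ j → P j → j ≤ N) →
  Σ ℕ λ m → P m × (∀ j → P j → j ≤ m)
greatest P? P0 zero    bound = 0 , P0 , bound
greatest {P} P? P0 (suc N) bound with P? (suc N)
... | yes PN = suc N , PN , bound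
... | no ¬PN = greatest P? P0 N λ j Pj → s≤s⁻¹ (≤∧≢⇒< (bound j Pj) λ { refl → ¬PN Pj })

scrambleOrder-≥ : ∀ H S {k} → OrderCond H S k → Σ ℕ λ m → IsScrambleOrder H S m × k ≤ m
scrambleOrder-≥ H S {k} oc with greatest (OrderCond? H S) (OrderCond-zero H S) (nV H) (λ _ → OrderCond⇒≤nV H S)
... | m , ocm , maximal = m , (ocm , maximal) , maximal k oc

IsScrambleNumber-transfer : ∀ {G H s} → (∀ k → Achievable G k ⇔ Achievable H k) →
  IsScrambleNumber G s → IsScrambleNumber H s
IsScrambleNumber-transfer {G} {H} {s} achievable ((S , ocS , _) , snG) =
  (T , ocT , λ j oc → atMost j (T , oc)) , λ T′ k (oc , _) → atMost k (T′ , oc)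
  where
  open Equivalence
  T   = proj₁ (to (achievable s) (S , ocS))
  ocT = proj₂ (to (achievable s) (S , ocS))

  atMost : ∀ k → Achievable H k → k ≤ s
  atMost k achH with from (achievable k) achH
  ... | U , ocU with scrambleOrder-≥ G U ocU
  ... | m , isOrder , k≤m = ≤-trans k≤m (snG U m isOrder)

singleton-egg-bound : ∀ H (S : Scramble H) {k} v → OrderCond H S k → Any (_⊆ ⁅ v ⁆) (eggs S) →
  k ≤ 1 ⊎ k ≤ cut H ⁅ v ⁆ (∁ ⁅ v ⁆)
singleton-egg-bound H S v (noHit , cutBound) inside with All.all? (v ∈?_) (eggs S)
... | yes allContain = inj₁ (≮⇒≥ λ 1<k →
  noHit ⁅ v ⁆ (subst (_< _) (sym (∣⁅x⁆∣≡1 v)) 1<k) (All.map (λ v∈E → v , x∈p∩q⁺ (x∈⁅x⁆ v , v∈E)) allContain))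
... | no ¬allContain = inj₂ (cutBound ⁅ v ⁆ inside (Any.map avoids (All.¬All⇒Any¬ (v ∈?_) (eggs S) ¬allContain)))
  where
  avoids : ∀ {E} → v ∉ E → E ⊆ ∁ ⁅ v ⁆
  avoids v∉E w∈E = x∉p⇒x∈∁p λ w∈⁅v⁆ → v∉E (subst (_∈ _) (x∈⁅y⁆⇒x≡y v w∈⁅v⁆) w∈E)

-- Subdividing one edge

-- The new vertex u = fromℕ n comes last, so a vertex set of G′ is written X ∷ʳ x, where
-- x records whether it contains u.
module SubdivideAt (G : Graph) (i : Fin (List.length (edges G))) where

  private
    n = nV G

  a b : Fin n
  a = proj₁ (List.lookup (edges G) i)
  b = proj₂ (List.lookup (edges G) i)

  rest : List (Fin n × Fin n)
  rest = removeAt (edges G) i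

  G′ : Graph
  G′ = subdivideAt G i

  u : Fin (suc n)
  u = fromℕ n

  lift : Fin n × Fin n → Fin (suc n) × Fin (suc n)
  lift (p , q) = inject₁ p , inject₁ q

  separated-removeAt : ∀ B X → separated B X (edges G) ≡ 𝟙 (separates B X (a , b)) + separated B X rest
  separated-removeAt B X = sum-map-removeAt (𝟙 ∘ separates B X) (edges G) i

  separated-lift : ∀ B β X x es → separated (B ∷ʳ β) (X ∷ʳ x) (map lift es) ≡ separated B X es
  separated-lift B β X x es = cong sum (trans (sym (map-∘ es)) (map-cong (cong 𝟙 ∘ separates-lift) es))
    where
    separates-lift : ∀ e → separates (B ∷ʳ β) (X ∷ʳ x) (lift e) ≡ separates B X e
    separates-lift (p , q)
      rewrite lookup-∷ʳ-inject₁ B β p | lookup-∷ʳ-inject₁ B β q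
            | lookup-∷ʳ-inject₁ X x p | lookup-∷ʳ-inject₁ X x q = refl

  separated-subdivideAt : ∀ B β X x → separated (B ∷ʳ β) (X ∷ʳ x) (edges G′) ≡
    𝟙 ((β ∧ lookup B a) ∧ (x xor lookup X a)) + 𝟙 ((β ∧ lookup B b) ∧ (x xor lookup X b)) + separated B X rest
  separated-subdivideAt B β X x = begin-equality
    𝟙 (separates B′ X′ (u , inject₁ a)) + (𝟙 (separates B′ X′ (u , inject₁ b)) + separated B′ X′ (map lift rest))
      ≡⟨ cong₂ _+_ (cong 𝟙 (separates-u a)) (cong₂ _+_ (cong 𝟙 (separates-u b)) (separated-lift B β X x rest)) ⟩
    𝟙 (viaU a) + (𝟙 (viaU b) + separated B X rest)
      ≡⟨ +-assoc (𝟙 (viaU a)) (𝟙 (viaU b)) (separated B X rest) ⟨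
    𝟙 (viaU a) + 𝟙 (viaU b) + separated B X rest ∎
    where
    B′ = B ∷ʳ β
    X′ = X ∷ʳ x
    viaU : Fin n → Bool
    viaU c = (β ∧ lookup B c) ∧ (x xor lookup X c)
    separates-u : ∀ c → separates B′ X′ (u , inject₁ c) ≡ viaU c
    separates-u c rewrite lookup-∷ʳ-fromℕ B β | lookup-∷ʳ-fromℕ X x
                        | lookup-∷ʳ-inject₁ B β c | lookup-∷ʳ-inject₁ X x c = refl

  separated-≤-subdivideAt : ∀ B β X x → (lookup B a ∧ lookup B b ≡ true → β ≡ true) →
    separated B X (edges G) ≤ separated (B ∷ʳ β) (X ∷ʳ x) (edges G′)
  separated-≤-subdivideAt B β X x ab⇒β = begin
    separated B X (edges G)
      ≡⟨ separated-removeAt B X ⟩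
    𝟙 (separates B X (a , b)) + separated B X rest
      ≤⟨ +-monoˡ-≤ _ (𝟙-edge≤path β (lookup B a) (lookup B b) x (lookup X a) (lookup X b) ab⇒β) ⟩
    𝟙 ((β ∧ lookup B a) ∧ (x xor lookup X a)) + 𝟙 ((β ∧ lookup B b) ∧ (x xor lookup X b)) + separated B X rest
      ≡⟨ separated-subdivideAt B β X x ⟨
    separated (B ∷ʳ β) (X ∷ʳ x) (edges G′) ∎

  separated-subdivideAt-≤ : ∀ B β X → let x = if lookup B a then lookup X a else lookup X b in
    separated (B ∷ʳ β) (X ∷ʳ x) (edges G′) ≤ separated B X (edges G)
  separated-subdivideAt-≤ B β X = begin
    separated (B ∷ʳ β) (X ∷ʳ x) (edges G′)
      ≡⟨ separated-subdivideAt B β X x ⟩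
    𝟙 ((β ∧ lookup B a) ∧ (x xor lookup X a)) + 𝟙 ((β ∧ lookup B b) ∧ (x xor lookup X b)) + separated B X rest
      ≤⟨ +-monoˡ-≤ _ (𝟙-path≤edge β (lookup B a) (lookup B b) (lookup X a) (lookup X b)) ⟩
    𝟙 (separates B X (a , b)) + separated B X rest
      ≡⟨ separated-removeAt B X ⟨
    separated B X (edges G) ∎
    where x = if lookup B a then lookup X a else lookup X b

  cut-∁-removeAt : ∀ A → cut G A (∁ A) ≡ 𝟙 (lookup A a xor lookup A b) + separated ⊤ A rest
  cut-∁-removeAt A = begin-equality
    cut G A (∁ A)                                  ≡⟨ cut-∁ G A ⟩
    separated ⊤ A (edges G)                        ≡⟨ separated-removeAt ⊤ A ⟩
    𝟙 (separates ⊤ A (a , b)) + separated ⊤ A rest ≡⟨ cong (λ c → 𝟙 c + separated ⊤ A rest) (separates-⊤ A a b) ⟩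
    𝟙 (lookup A a xor lookup A b) + separated ⊤ A rest ∎

  cut-∁-subdivideAt : ∀ A x →
    cut G′ (A ∷ʳ x) (∁ (A ∷ʳ x)) ≡ 𝟙 (x xor lookup A a) + 𝟙 (x xor lookup A b) + separated ⊤ A rest
  cut-∁-subdivideAt A x = begin-equality
    cut G′ (A ∷ʳ x) (∁ (A ∷ʳ x))
      ≡⟨ cut-∁ G′ (A ∷ʳ x) ⟩
    separated ⊤ (A ∷ʳ x) (edges G′)
      ≡⟨ cong (λ B → separated B (A ∷ʳ x) (edges G′)) (⊤-∷ʳ n) ⟩
    separated (⊤ ∷ʳ true) (A ∷ʳ x) (edges G′)
      ≡⟨ separated-subdivideAt ⊤ true A x ⟩
    𝟙 ((true ∧ lookup ⊤ a) ∧ (x xor lookup A a)) + 𝟙 ((true ∧ lookup ⊤ b) ∧ (x xor lookup A b)) + separated ⊤ A rest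
      ≡⟨ cong (_+ separated ⊤ A rest) (cong₂ _+_ (drop-⊤ a) (drop-⊤ b)) ⟩
    𝟙 (x xor lookup A a) + 𝟙 (x xor lookup A b) + separated ⊤ A rest ∎
    where
    drop-⊤ : ∀ c {y} → 𝟙 ((true ∧ lookup ⊤ c) ∧ y) ≡ 𝟙 y
    drop-⊤ c rewrite lookup-replicate c true = refl

  cut-∁-≤-subdivideAt : ∀ A x → cut G A (∁ A) ≤ cut G′ (A ∷ʳ x) (∁ (A ∷ʳ x))
  cut-∁-≤-subdivideAt A x = begin
    cut G A (∁ A)
      ≡⟨ cut-∁-removeAt A ⟩
    𝟙 (lookup A a xor lookup A b) + separated ⊤ A rest
      ≤⟨ +-monoˡ-≤ _ (𝟙-xor-triangle x (lookup A a) (lookup A b)) ⟩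
    𝟙 (x xor lookup A a) + 𝟙 (x xor lookup A b) + separated ⊤ A rest
      ≡⟨ cut-∁-subdivideAt A x ⟨
    cut G′ (A ∷ʳ x) (∁ (A ∷ʳ x)) ∎

  cut-∁-subdivideAt-between : ∀ A x → x ≡ lookup A a ⊎ x ≡ lookup A b →
    cut G′ (A ∷ʳ x) (∁ (A ∷ʳ x)) ≡ cut G A (∁ A)
  cut-∁-subdivideAt-between A x between = begin-equality
    cut G′ (A ∷ʳ x) (∁ (A ∷ʳ x))
      ≡⟨ cut-∁-subdivideAt A x ⟩
    𝟙 (x xor lookup A a) + 𝟙 (x xor lookup A b) + separated ⊤ A rest
      ≡⟨ cong (_+ separated ⊤ A rest) (𝟙-xor-between x (lookup A a) (lookup A b) between) ⟩
    𝟙 (lookup A a xor lookup A b) + separated ⊤ A rest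
      ≡⟨ cut-∁-removeAt A ⟨
    cut G A (∁ A) ∎

  cut-⁅u⁆ : cut G′ ⁅ u ⁆ (∁ ⁅ u ⁆) ≤ 2
  cut-⁅u⁆ rewrite ⁅fromℕ⁆ n = begin
    cut G′ (⊥ ∷ʳ true) (∁ (⊥ ∷ʳ true))
      ≡⟨ cut-∁-subdivideAt ⊥ true ⟩
    𝟙 (not (lookup ⊥ a)) + 𝟙 (not (lookup ⊥ b)) + separated ⊤ ⊥ rest
      ≤⟨ +-mono-≤ (+-mono-≤ (𝟙≤1 (not (lookup ⊥ a))) (𝟙≤1 (not (lookup ⊥ b)))) (≤-reflexive (separated-⊥ ⊤ rest)) ⟩
    2 ∎

  u–a-separated : ∀ B β X x → β ≡ true → lookup B a ∧ (x xor lookup X a) ≡ true →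
    1 ≤ separated (B ∷ʳ β) (X ∷ʳ x) (edges G′)
  u–a-separated B β X x refl separatedUA = begin
    1                                                   ≡⟨ cong 𝟙 separatedUA ⟨
    𝟙 (lookup B a ∧ (x xor lookup X a))                 ≤⟨ m≤m+n _ _ ⟩
    𝟙 (lookup B a ∧ (x xor lookup X a)) + 𝟙 (lookup B b ∧ (x xor lookup X b))
                                                        ≤⟨ m≤m+n _ _ ⟩
    𝟙 (lookup B a ∧ (x xor lookup X a)) + 𝟙 (lookup B b ∧ (x xor lookup X b)) + separated B X rest
                                                        ≡⟨ separated-subdivideAt B true X x ⟨
    separated (B ∷ʳ true) (X ∷ʳ x) (edges G′)           ∎

  liftEgg : Subset n → Subset (suc n)
  liftEgg E = E ∷ʳ lookup E a

  liftEgg-connected : ∀ {E} → ConnectedSet G E → ConnectedSet G′ (liftEgg E)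
  liftEgg-connected {E} connE = separated⇒connected G′ (Nonempty-∷ʳ⁺ _ (proj₁ connE)) splitting
    where
    splitting : ∀ X′ → Nonempty (liftEgg E ∩ X′) → Nonempty (liftEgg E ─ X′) → 1 ≤ separated (liftEgg E) X′ (edges G′)
    splitting X′ with initLast X′
    ... | X , x , refl with lookup E a ∧ (x xor lookup X a) Bool.≟ true
    ... | yes separatedUA = λ _ _ → u–a-separated E _ X x (proj₁ (∧≡true⁻ {lookup E a} separatedUA)) separatedUA
    ... | no ¬separatedUA = λ meets misses → begin
      1
        ≤⟨ connected⇒separated G connE (restrict meets ∩-at-a) (restrict misses ─-at-a) ⟩
      separated E X (edges G)
        ≤⟨ separated-≤-subdivideAt E (lookup E a) X x (λ ab → proj₁ (∧≡true⁻ ab)) ⟩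
      separated (liftEgg E) (X ∷ʳ x) (edges G′) ∎
      where
      agree = ∧-xor≡false⇒ (lookup E a) x (lookup X a) (¬-not ¬separatedUA)
      ∩-at-a : liftEgg E ∩ (X ∷ʳ x) ≡ (E ∩ X) ∷ʳ lookup (E ∩ X) a
      ∩-at-a = trans (∩-∷ʳ E X _ x) (cong ((E ∩ X) ∷ʳ_) (trans (proj₁ agree) (sym (lookup-∩ E X a))))
      ─-at-a : liftEgg E ─ (X ∷ʳ x) ≡ (E ─ X) ∷ʳ lookup (E ─ X) a
      ─-at-a = trans (─-∷ʳ E X _ x) (cong ((E ─ X) ∷ʳ_) (trans (proj₂ agree) (sym (lookup-─ E X a))))
      restrict : ∀ {Y p} → Nonempty Y → Y ≡ p ∷ʳ lookup p a → Nonempty p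
      restrict {p = p} ne refl = Nonempty-∷ʳ-lookup⁻ p a ne

  liftScramble : Scramble G → Scramble G′
  liftScramble S = mkScramble (map liftEgg (eggs S)) (All.map⁺ (All.map liftEgg-connected (connected S)))

  absorbed : Bool → Subset n → Subset n
  absorbed true  C = ⁅ a ⁆ ∪ C
  absorbed false C = C

  ∣absorbed∣ : ∀ c C → ∣ absorbed c C ∣ ≤ ∣ C ∣ + 𝟙 c
  ∣absorbed∣ true  C = ≤-trans (∣p∪q∣≤∣p∣+∣q∣ ⁅ a ⁆ C)
    (≤-reflexive (trans (cong (_+ ∣ C ∣) (∣⁅x⁆∣≡1 a)) (+-comm 1 ∣ C ∣)))
  ∣absorbed∣ false C = m≤m+n ∣ C ∣ 0

  absorbed-hits : ∀ c C E → Nonempty ((C ∷ʳ c) ∩ liftEgg E) → Nonempty (absorbed c C ∩ E)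
  absorbed-hits c C E hit with Nonempty-∷ʳ⁻ (C ∩ E) (subst Nonempty (∩-∷ʳ C E c (lookup E a)) hit)
  absorbed-hits c     C E hit | inj₁ (j , j∈C∩E) = j , x∈p∩q⁺ (C⊆absorbed c j∈C , j∈E)
    where
    j∈C = proj₁ (x∈p∩q⁻ C E j∈C∩E)
    j∈E = proj₂ (x∈p∩q⁻ C E j∈C∩E)
    C⊆absorbed : ∀ c → C ⊆ absorbed c C
    C⊆absorbed true  = q⊆p∪q ⁅ a ⁆ C
    C⊆absorbed false = λ j∈ → j∈
  absorbed-hits true  C E hit | inj₂ a∈E = a , x∈p∩q⁺ (x∈p∪q⁺ (inj₁ (x∈⁅x⁆ a)) , lookup⇒[]= a E a∈E)
  absorbed-hits false C E hit | inj₂ ()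

  liftScramble-order : ∀ S {k} → OrderCond G S k → OrderCond G′ (liftScramble S) k
  liftScramble-order S {k} (noHit , cutBound) = noHit′ , cutBound′
    where
    noHit′ : ∀ C′ → ∣ C′ ∣ < k → ¬ HittingSet G′ C′ (liftScramble S)
    noHit′ C′ with initLast C′
    ... | C , c , refl = λ small hits → noHit (absorbed c C)
      (≤-<-trans (∣absorbed∣ c C) (subst (_< k) (∣∷ʳ∣ C c) small))
      (All.map (absorbed-hits c C _) (All.map⁻ hits))

    cutBound′ : ∀ A′ → Any (_⊆ A′) (map liftEgg (eggs S)) → Any (_⊆ ∁ A′) (map liftEgg (eggs S)) →
      k ≤ cut G′ A′ (∁ A′)
    cutBound′ A′ with initLast A′
    ... | A , x , refl = λ inside outside → ≤-trans
      (cutBound A (Any.map ∷ʳ-⊆⁻ (Any.map⁻ inside))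
                  (Any.map ⊆∁ (Any.map⁻ outside)))
      (cut-∁-≤-subdivideAt A x)
      where
      ⊆∁ : ∀ {E} → liftEgg E ⊆ ∁ (A ∷ʳ x) → E ⊆ ∁ A
      ⊆∁ {E} E⊆ = ∷ʳ-⊆⁻ (subst (liftEgg E ⊆_) (∁-∷ʳ A x) E⊆)

  achievable-subdivideAt : ∀ {k} → Achievable G k → Achievable G′ k
  achievable-subdivideAt (S , oc) = liftScramble S , liftScramble-order S oc

  restrict-connected : ∀ {E t} → ConnectedSet G′ (E ∷ʳ t) → Nonempty E → ConnectedSet G E
  restrict-connected {E} {t} connE′ nonempty = separated⇒connected G nonempty splitting
    where
    splitting : ∀ X → Nonempty (E ∩ X) → Nonempty (E ─ X) → 1 ≤ separated E X (edges G)
    splitting X meets misses = begin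
      1                                      ≤⟨ connected⇒separated G′ connE′
                                                  (subst Nonempty (sym (∩-∷ʳ E X t x)) (Nonempty-∷ʳ⁺ _ meets))
                                                  (subst Nonempty (sym (─-∷ʳ E X t x)) (Nonempty-∷ʳ⁺ _ misses)) ⟩
      separated (E ∷ʳ t) (X ∷ʳ x) (edges G′) ≤⟨ separated-subdivideAt-≤ E t X ⟩
      separated E X (edges G)                ∎
      where
      -- u joins the side of a (of b when a ∉ E), so an edge of a–u–b inside E is separated
      -- only if ab is.
      x = if lookup E a then lookup X a else lookup X b

  u-neighbour : ∀ {E} → ConnectedSet G′ (E ∷ʳ true) → Nonempty E → a ∈ E ⊎ b ∈ E
  u-neighbour {E} connE′ nonempty = neighbour (not (lookup ⊥ a)) (not (lookup ⊥ b)) (begin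
    1                                                  ≤⟨ connected⇒separated G′ connE′ meets misses ⟩
    separated (E ∷ʳ true) (⊥ ∷ʳ true) (edges G′)       ≡⟨ separated-subdivideAt E true ⊥ true ⟩
    via a + via b + separated E ⊥ rest                 ≡⟨ cong (via a + via b +_) (separated-⊥ E rest) ⟩
    via a + via b + 0                                  ∎)
    where
    via : Fin n → ℕ
    via c = 𝟙 (lookup E c ∧ not (lookup ⊥ c))
    meets : Nonempty ((E ∷ʳ true) ∩ (⊥ ∷ʳ true))
    meets = u , subst (u ∈_) (sym (∩-∷ʳ E ⊥ true true)) (fromℕ∈∷ʳ (E ∩ ⊥))
    misses : Nonempty ((E ∷ʳ true) ─ (⊥ ∷ʳ true))
    misses = subst Nonempty (sym (trans (─-∷ʳ E ⊥ true true) (cong (_∷ʳ false) (p─⊥≡p E))))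
      (Nonempty-∷ʳ⁺ false nonempty)
    neighbour : ∀ y z → 1 ≤ 𝟙 (lookup E a ∧ y) + 𝟙 (lookup E b ∧ z) + 0 → a ∈ E ⊎ b ∈ E
    neighbour y z pos with lookup E a in Ea | lookup E b in Eb
    ... | true  | _     = inj₁ (lookup⇒[]= a E Ea)
    ... | false | true  = inj₂ (lookup⇒[]= b E Eb)
    ... | false | false = contradiction pos λ ()

  contract : Fin n → Subset (suc n) → Subset n
  contract c E′ with nonempty? (init E′)
  ... | yes _ = init E′
  ... | no  _ = ⁅ c ⁆

  contract-connected : ∀ c {E′} → ConnectedSet G′ E′ → ConnectedSet G (contract c E′)
  contract-connected c {E′} connE′ with nonempty? (init E′)
  ... | yes nonempty = restrict-connected (subst (ConnectedSet G′) (init-∷ʳ-last E′) connE′) nonempty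
  ... | no  _        = ⁅⁆-connected G c

  contract-nonempty : ∀ c E′ → Nonempty (init E′) → contract c E′ ≡ init E′
  contract-nonempty c E′ nonempty with nonempty? (init E′)
  ... | yes _     = refl
  ... | no  empty = contradiction nonempty empty

  contract-empty : ∀ c E′ → Empty (init E′) → contract c E′ ≡ ⁅ c ⁆
  contract-empty c E′ empty with nonempty? (init E′)
  ... | yes nonempty = contradiction nonempty empty
  ... | no  _        = refl

  contract-⊆ : ∀ c E′ {T} → contract c E′ ⊆ T → init E′ ⊆ T
  contract-⊆ c E′ contract⊆T with nonempty? (init E′)
  ... | yes _     = contract⊆T
  ... | no  empty = λ j∈ → contradiction (_ , j∈) empty

  contract-⊆-u : ∀ {E′ T} → ConnectedSet G′ E′ → contract a E′ ⊆ T ⊎ contract b E′ ⊆ T →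
    last E′ ≡ true → a ∈ T ⊎ b ∈ T
  contract-⊆-u {E′} {T} connE′ contract⊆T u∈E′ with nonempty? (init E′)
  ... | yes nonempty = Sum.map init⊆T init⊆T
        (u-neighbour (subst (ConnectedSet G′) (trans (init-∷ʳ-last E′) (cong (init E′ ∷ʳ_) u∈E′)) connE′) nonempty)
    where
    init⊆T : init E′ ⊆ T
    init⊆T = Sum.reduce contract⊆T
  ... | no _ = Sum.map (λ ⁅a⁆⊆T → ⁅a⁆⊆T (x∈⁅x⁆ a)) (λ ⁅b⁆⊆T → ⁅b⁆⊆T (x∈⁅x⁆ b)) contract⊆T

  -- contract a E′ and contract b E′ differ only for an egg E′ ⊆ {u}, which becomes {a} and {b}.
  contractEggs : List (Subset (suc n)) → List (Subset n)
  contractEggs []        = []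
  contractEggs (E′ ∷ Es) = contract a E′ ∷ contract b E′ ∷ contractEggs Es

  contractScramble : Scramble G′ → Scramble G
  contractScramble S′ = mkScramble (contractEggs (eggs S′)) (contracted (connected S′))
    where
    contracted : ∀ {Es} → All (ConnectedSet G′) Es → All (ConnectedSet G) (contractEggs Es)
    contracted []               = []
    contracted (connE′ ∷ conns) = contract-connected a connE′ ∷ contract-connected b connE′ ∷ contracted conns

  All-contractEggs⁻ : ∀ {P : Subset n → Set} Es → All P (contractEggs Es) →
    All (λ E′ → P (contract a E′) × P (contract b E′)) Es
  All-contractEggs⁻ []        []                = []
  All-contractEggs⁻ (E′ ∷ Es) (pa ∷ pb ∷ ps) = (pa , pb) ∷ All-contractEggs⁻ Es ps

  Any-contractEggs⁻ : ∀ {P : Subset n → Set} Es → Any P (contractEggs Es) →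
    Any (λ E′ → P (contract a E′) ⊎ P (contract b E′)) Es
  Any-contractEggs⁻ (E′ ∷ Es) (Any.here pa)               = Any.here (inj₁ pa)
  Any-contractEggs⁻ (E′ ∷ Es) (Any.there (Any.here pb))   = Any.here (inj₂ pb)
  Any-contractEggs⁻ (E′ ∷ Es) (Any.there (Any.there ps)) = Any.there (Any-contractEggs⁻ Es ps)

  contract-hit-nonempty : ∀ {C} E′ → Nonempty (init E′) → Nonempty (C ∩ contract a E′) → Nonempty ((C ∷ʳ false) ∩ E′)
  contract-hit-nonempty {C} E′ nonempty hit =
    subst (λ F → Nonempty ((C ∷ʳ false) ∩ F)) (sym (init-∷ʳ-last E′))
      (subst Nonempty (sym (∩-∷ʳ C (init E′) false (last E′)))
        (Nonempty-∷ʳ⁺ _ (subst (λ D → Nonempty (C ∩ D)) (contract-nonempty a E′ nonempty) hit)))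

  contract-hit-empty : ∀ {C} c E′ → Empty (init E′) → Nonempty (C ∩ contract c E′) → c ∈ C
  contract-hit-empty {C} c E′ empty hit with subst (λ D → Nonempty (C ∩ D)) (contract-empty c E′ empty) hit
  ... | j , j∈C∩⁅c⁆ = subst (_∈ C) (x∈⁅y⁆⇒x≡y c (proj₂ (x∈p∩q⁻ C ⁅ c ⁆ j∈C∩⁅c⁆))) (proj₁ (x∈p∩q⁻ C ⁅ c ⁆ j∈C∩⁅c⁆))

  empty-init⇒⊆⁅u⁆ : ∀ {E′} → Empty (init E′) → E′ ⊆ ⁅ u ⁆
  empty-init⇒⊆⁅u⁆ empty =
    subst (_ ⊆_) (sym (⁅fromℕ⁆ n)) (⊆-∷ʳ-init (λ j∈ → contradiction (_ , j∈) empty) (λ _ → refl))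

  module ContractOrder (S′ : Scramble G′) {k} (oc : OrderCond G′ S′ k) where

    private
      Es = eggs S′
      noHit = proj₁ oc
      cutBound = proj₂ oc

    egg⊆⁅u⁆⇒k≤2 : Any (_⊆ ⁅ u ⁆) Es → k ≤ 2
    egg⊆⁅u⁆⇒k≤2 uEgg with singleton-egg-bound G′ S′ u oc uEgg
    ... | inj₁ k≤1   = ≤-trans k≤1 (s≤s z≤n)
    ... | inj₂ k≤cut = ≤-trans k≤cut cut-⁅u⁆

    contract-noHit : a ≢ b → ∀ C → ∣ C ∣ < k → ¬ HittingSet G C (contractScramble S′)
    contract-noHit a≢b C small hits with All.all? (nonempty? ∘ init) Es
    ... | yes allNonempty = noHit (C ∷ʳ false) (subst (_< k) (sym (trans (∣∷ʳ∣ C false) (+-identityʳ ∣ C ∣))) small)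
      (All.zipWith (λ (nonempty , hitA , _) → contract-hit-nonempty _ nonempty hitA)
                   (allNonempty , All-contractEggs⁻ Es hits))
    ... | no someEmpty =
      let uEgg                  = All.¬All⇒Any¬ (nonempty? ∘ init) Es someEmpty
          (hitA , hitB) , empty = All.lookupAny (All-contractEggs⁻ Es hits) uEgg
          a∈C = contract-hit-empty a _ empty hitA
          b∈C = contract-hit-empty b _ empty hitB
      in <⇒≱ (≤-<-trans (two≤∣p∣ a≢b a∈C b∈C) small) (egg⊆⁅u⁆⇒k≤2 (Any.map empty-init⇒⊆⁅u⁆ uEgg))

    lifted-cut-bound : ∀ A y → y ≡ lookup A a ⊎ y ≡ lookup A b →
      Any (_⊆ A ∷ʳ y) Es → Any (_⊆ ∁ (A ∷ʳ y)) Es → k ≤ cut G A (∁ A)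
    lifted-cut-bound A y between inside outside =
      subst (k ≤_) (cut-∁-subdivideAt-between A y between) (cutBound (A ∷ʳ y) inside outside)

    ⊆∁∷ʳ : ∀ {E′ : Subset (suc n)} {A y} → E′ ⊆ ∁ A ∷ʳ not y → E′ ⊆ ∁ (A ∷ʳ y)
    ⊆∁∷ʳ {E′} {A} {y} = subst (E′ ⊆_) (sym (∁-∷ʳ A y))

    module Separating (A : Subset n) (Aa≢Ab : lookup A a ≢ lookup A b)
                      (inside : Any (λ E′ → init E′ ⊆ A) Es) (outside : Any (λ E′ → init E′ ⊆ ∁ A) Es) where

      -- It has at most |E(A, ∁A)| elements and meets every egg not lying on one side of A.
      C′ : Subset (suc n)
      C′ = sourcesOf (separates ⊤ A) rest ∷ʳ true

      ∣C′∣≤cut : ∣ C′ ∣ ≤ cut G A (∁ A)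
      ∣C′∣≤cut = begin
        ∣ sourcesOf (separates ⊤ A) rest ∷ʳ true ∣ ≡⟨ ∣∷ʳ∣ (sourcesOf (separates ⊤ A) rest) true ⟩
        ∣ sourcesOf (separates ⊤ A) rest ∣ + 1     ≤⟨ +-monoˡ-≤ 1 (∣sourcesOf∣ (separates ⊤ A) rest) ⟩
        separated ⊤ A rest + 1                     ≡⟨ +-comm (separated ⊤ A rest) 1 ⟩
        1 + separated ⊤ A rest                     ≡⟨ cong (λ c → 𝟙 c + separated ⊤ A rest) (≢⇒xor Aa≢Ab) ⟨
        𝟙 (lookup A a xor lookup A b) + separated ⊤ A rest ≡⟨ cut-∁-removeAt A ⟨
        cut G A (∁ A) ∎

      lift-init : ∀ {T} {E′ : Subset (suc n)} → init E′ ⊆ T → E′ ⊆ T ∷ʳ true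
      lift-init init⊆T = ⊆-∷ʳ-init init⊆T (λ _ → refl)

      separated-edge-hit : ∀ {E} → Any (λ e → separates E A e ≡ true) rest → Nonempty (C′ ∩ (E ∷ʳ false))
      separated-edge-hit {E} separatedE with find separatedE
      ... | (p , q) , e∈rest , pq-separatedE with ∧≡true⁻ {lookup E p ∧ lookup E q} pq-separatedE
      ... | pq∈E , pq-separatedA =
        inject₁ p , subst (inject₁ p ∈_) (sym (∩-∷ʳ _ E true false)) (inject₁∈∷ʳ false (x∈p∩q⁺ (p∈sources , p∈E)))
        where
        p∈sources = sourcesOf-∈ (separates ⊤ A) e∈rest (trans (separates-⊤ A p q) pq-separatedA)
        p∈E = lookup⇒[]= p E (proj₁ (∧≡true⁻ pq∈E))

      hit-or-bound : ∀ {E′} → E′ ∈ₗ Es → ConnectedSet G′ E′ → k ≤ cut G A (∁ A) ⊎ Nonempty (C′ ∩ E′)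
      hit-or-bound {E′} E′∈ connE′ with initLast E′
      ... | E , true  , refl = inj₂ (u , subst (u ∈_) (sym (∩-∷ʳ _ E true true)) (fromℕ∈∷ʳ _))
      ... | E , false , refl with nonempty? (E ∩ A) | nonempty? (E ─ A)
      ...   | no E∩A-empty | _ = inj₁ (lifted-cut-bound A true (≢⇒either Aa≢Ab true)
                (Any.map lift-init inside) (lose E′∈ (⊆∁∷ʳ (∷ʳ-⊆⁺ E⊆∁A λ ()))))
        where
        E⊆∁A : E ⊆ ∁ A
        E⊆∁A j∈E = x∉p⇒x∈∁p λ j∈A → E∩A-empty (_ , x∈p∩q⁺ (j∈E , j∈A))
      ...   | yes _ | no E─A-empty = inj₁ (lifted-cut-bound A false (≢⇒either Aa≢Ab false)
                (lose E′∈ (∷ʳ-⊆⁺ E⊆A λ ())) (Any.map (⊆∁∷ʳ ∘ lift-init) outside))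
        where
        E⊆A : E ⊆ A
        E⊆A {j} j∈E with j ∈? A
        ... | yes j∈A = j∈A
        ... | no  j∉A = contradiction (_ , x∈p∧x∉q⇒x∈p─q j∈E j∉A) E─A-empty
      ...   | yes meets | yes misses = inj₂ (separated-edge-hit (1≤sum-𝟙⇒Any (separates E A) rest (begin
          1                                            ≤⟨ connected⇒separated G′ connE′ meets′ misses′ ⟩
          separated (E ∷ʳ false) (A ∷ʳ false) (edges G′) ≡⟨ separated-subdivideAt E false A false ⟩
          separated E A rest                           ∎)))
        where
        meets′ : Nonempty ((E ∷ʳ false) ∩ (A ∷ʳ false))
        meets′ = subst Nonempty (sym (∩-∷ʳ E A false false)) (Nonempty-∷ʳ⁺ false meets)
        misses′ : Nonempty ((E ∷ʳ false) ─ (A ∷ʳ false))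
        misses′ = subst Nonempty (sym (─-∷ʳ E A false false)) (Nonempty-∷ʳ⁺ false misses)

      separating-cut-bound : k ≤ cut G A (∁ A)
      separating-cut-bound with k ≤? cut G A (∁ A)
      ... | yes k≤cut = k≤cut
      ... | no  k≰cut = contradiction (All.tabulate hit) (noHit C′ (≤-<-trans ∣C′∣≤cut (≰⇒> k≰cut)))
        where
        hit : ∀ {E′} → E′ ∈ₗ Es → Nonempty (C′ ∩ E′)
        hit E′∈ = Sum.[ (λ k≤cut → contradiction k≤cut k≰cut) , (λ hitE′ → hitE′) ]
                        (hit-or-bound E′∈ (All.lookup (connected S′) E′∈))

    contracted-⊆ : ∀ {E′ T} → contract a E′ ⊆ T ⊎ contract b E′ ⊆ T → init E′ ⊆ T
    contracted-⊆ {E′} = Sum.[ contract-⊆ a E′ , contract-⊆ b E′ ]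

    lift-contracted : ∀ {T y} → lookup T a ≡ y → lookup T b ≡ y →
      Any (λ E′ → contract a E′ ⊆ T ⊎ contract b E′ ⊆ T) Es → Any (_⊆ T ∷ʳ y) Es
    lift-contracted Ta Tb contracted⊆T with find contracted⊆T
    ... | E′ , E′∈ , ⊆T = lose E′∈ (⊆-∷ʳ-init (contracted-⊆ ⊆T) λ u∈E′ →
      Sum.[ (λ a∈T → trans (sym Ta) ([]=⇒lookup a∈T)) , (λ b∈T → trans (sym Tb) ([]=⇒lookup b∈T)) ]
        (contract-⊆-u (All.lookup (connected S′) E′∈) ⊆T u∈E′))

    contract-cutBound : ∀ A → Any (_⊆ A) (contractEggs Es) → Any (_⊆ ∁ A) (contractEggs Es) → k ≤ cut G A (∁ A)
    contract-cutBound A inside outside with lookup A a Bool.≟ lookup A b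
    ... | no Aa≢Ab = Separating.separating-cut-bound A Aa≢Ab
      (Any.map contracted-⊆ (Any-contractEggs⁻ Es inside)) (Any.map contracted-⊆ (Any-contractEggs⁻ Es outside))
    ... | yes Aa≡Ab = lifted-cut-bound A (lookup A a) (inj₁ refl)
      (lift-contracted refl (sym Aa≡Ab) (Any-contractEggs⁻ Es inside))
      (Any.map ⊆∁∷ʳ (lift-contracted (lookup-map a not A) (trans (lookup-map b not A) (cong not (sym Aa≡Ab)))
        (Any-contractEggs⁻ Es outside)))

  contractScramble-order : a ≢ b → ∀ S′ {k} → OrderCond G′ S′ k → OrderCond G (contractScramble S′) k
  contractScramble-order a≢b S′ oc = ContractOrder.contract-noHit S′ oc a≢b , ContractOrder.contract-cutBound S′ oc

  achievable-subdivideAt⁻ : a ≢ b → ∀ {k} → Achievable G′ k → Achievable G k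
  achievable-subdivideAt⁻ a≢b (S′ , oc) = contractScramble S′ , contractScramble-order a≢b S′ oc

-- Subdivisions

loopless-subdivideAt : ∀ G i → Loopless G → Loopless (subdivideAt G i)
loopless-subdivideAt G i loopless =
  fromℕ≢inject₁ ∷ fromℕ≢inject₁ ∷ All.map⁺ (All.map (_∘ inject₁-injective) (All-removeAt loopless i))
  where
  All-removeAt : ∀ {A : Set} {P : A → Set} {xs} → All P xs → ∀ j → All P (removeAt xs j)
  All-removeAt (px ∷ pxs) zero    = pxs
  All-removeAt (px ∷ pxs) (suc j) = px ∷ All-removeAt pxs j

loopless-subdivision : ∀ {G H} → Loopless G → Subdivision G H → Loopless H
loopless-subdivision loopless here           = loopless
loopless-subdivision loopless (step {H} sub i) = loopless-subdivideAt H i (loopless-subdivision loopless sub)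

achievable-subdivision : ∀ {G H} → Loopless G → Subdivision G H → ∀ k → Achievable G k ⇔ Achievable H k
achievable-subdivision loopless here             k = ⇔-refl
achievable-subdivision loopless (step {H} sub i) k = ⇔-trans (achievable-subdivision loopless sub k)
  (mk⇔ (SubdivideAt.achievable-subdivideAt H i)
       (SubdivideAt.achievable-subdivideAt⁻ H i (All.lookup (loopless-subdivision loopless sub) (∈-lookup i))))

proposition4p6 : (G G' : Graph) → Loopless G → ConnectedGraph G → Subdivision G G'
    → (s : ℕ) → IsScrambleNumber G s ⇔ IsScrambleNumber G' s
proposition4p6 G G' loopless _ subdivision s =
  mk⇔ (IsScrambleNumber-transfer achievable) (IsScrambleNumber-transfer (⇔-sym ∘ achievable))
  where
  achievable = achievable-subdivision loopless subdivision
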